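{- An optiongraph $\mathsf{D}$ has no terminal position if and only if its minimum quotient $\mathsf{D}/{\bowtie}$ is a one-vertex loop, i.e. consists of a single position $x$ with $\mathrm{Opt}(x)=\{x\}$.
   Context: An optiongraph is a nonempty set $\mathsf{D}$ (of positions, possibly infinite) together with an option function $\mathrm{Opt}_{\mathsf{D}}:\mathsf{D}\to 2^{\mathsf{D}}$. A terminal position is one with empty option set. For an equivalence relation $\theta$, write $[p]$ for the class of $p$ and $[S]:=\{[s]\mid s\in S\}$. An equivalence relation on $\mathsf{D}$ is a congruence relation if $p\mathrel{\theta}q$ implies $[\mathrm{Opt}(p)]=[\mathrm{Opt}(q)]$. $\bowtie$ denotes the union of all congruence relations on $\mathsf{D}$, which is itself a congruence relation (the maximum one). The quotient optiongraph $\mathsf{D}/{\bowtie}$ (the minimum quotient) is the set of classes with option function $\mathrm{Opt}([p]):=[\mathrm{Opt}_{\mathsf{D}}(p)]$. -}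

module Defs where

open import Level using (Level; suc; _⊔_)
open import Data.Product using (Σ; ∃; _×_; _,_)
open import Relation.Nullary using (¬_)
open import Relation.Unary using (Pred; _∈_)
open import Relation.Binary using (Rel; IsEquivalence)
open import Relation.Binary.PropositionalEquality using (_≡_)

record Optiongraph (ℓ : Level) : Set (suc ℓ) where
  field
    Pos      : Set ℓ
    Opt      : Pos → Pred Pos ℓ
    nonempty : Pos

module _ {ℓ : Level} (D : Optiongraph ℓ) where
  open Optiongraph D

  Terminal : Pos → Set ℓ
  Terminal p = ∀ s → ¬ (s ∈ Opt p)

  -- [A] = [B] for subsets A, B of D, where [S] = { [s] | s ∈ S } for the
  -- classes of the relation θ
  ClassSetEq : {ℓ' : Level} → Rel Pos ℓ' → Pred Pos ℓ → Pred Pos ℓ → Set (ℓ ⊔ ℓ')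
  ClassSetEq θ A B =
    (∀ a → a ∈ A → ∃ λ b → b ∈ B × θ a b) ×
    (∀ b → b ∈ B → ∃ λ a → a ∈ A × θ a b)

  record IsCongruence (θ : Rel Pos ℓ) : Set ℓ where
    field
      isEquivalence : IsEquivalence θ
      compatible    : ∀ {p q} → θ p q → ClassSetEq θ (Opt p) (Opt q)

  _⋈_ : Rel Pos (suc ℓ)
  p ⋈ q = Σ (Rel Pos ℓ) λ θ → IsCongruence θ × θ p q

  -- The minimum quotient D/⋈ (classes of ⋈, Opt([p]) = [Opt(p)]) is a
  -- one-vertex loop: it has a single position [x] (every p lies in the class
  -- of x), and Opt([x]) = {[x]}, i.e. [Opt x] = [{x}].
  QuotientIsOneVertexLoop : Set (suc ℓ)
  QuotientIsOneVertexLoop =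
    ∃ λ x → (∀ p → p ⋈ x) × ClassSetEq _⋈_ (Opt x) (λ s → s ≡ x)

{-# OPTIONS --safe #-}
-- If no position is terminal, every option set is nonempty, so all classes
-- [Opt p] coincide under the total relation, which is therefore a congruence;
-- hence ⋈ is total and D/⋈ is a single looped vertex. Conversely, the
-- compatibility clause of a congruence transports the existence of an option
-- from q to any p related to q; in a one-vertex loop every p is related to x,
-- and x has an option.
module Submission where

open import Defs
open import Level using (Level)
open import Data.Product using (_×_; _,_; ∃)
open import Relation.Nullary using (¬_)
open import Relation.Unary using (Pred; _∈_)
open import Relation.Binary using (Rel)
open import Relation.Binary.PropositionalEquality using (refl)
open import Relation.Binary.Construct.Always as Always using (Always)
open import Axiom.ExcludedMiddle using (ExcludedMiddle)
open import Axiom.DoubleNegationElimination using (em⇒dne)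

module _ {ℓ : Level} (D : Optiongraph ℓ) where
  open Optiongraph D

  Inhabited : Pred Pos ℓ → Set ℓ
  Inhabited A = ∃ λ a → a ∈ A

  HasOption : Pos → Set ℓ
  HasOption p = Inhabited (Opt p)

  ¬terminal⇒hasOption : ExcludedMiddle ℓ → ∀ {p} → ¬ Terminal D p → HasOption p
  ¬terminal⇒hasOption em ¬terminal =
    em⇒dne em λ noOption → ¬terminal λ s s∈Opt → noOption (s , s∈Opt)

  hasOption⇒¬terminal : ∀ {p} → HasOption p → ¬ Terminal D p
  hasOption⇒¬terminal (s , s∈Opt) terminal = terminal s s∈Opt

  ClassSetEq-total : ∀ {ℓ′} {θ : Rel Pos ℓ′} {A B} → (∀ a b → θ a b) →
                     Inhabited A → Inhabited B → ClassSetEq D θ A B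
  ClassSetEq-total θ-total (a , a∈A) (b , b∈B) =
    (λ a′ _ → b , b∈B , θ-total a′ b) ,
    (λ b′ _ → a , a∈A , θ-total a b′)

  ClassSetEq-inhabitedʳ⇒inhabitedˡ : ∀ {ℓ′} {θ : Rel Pos ℓ′} {A B} →
                                     ClassSetEq D θ A B → Inhabited B → Inhabited A
  ClassSetEq-inhabitedʳ⇒inhabitedˡ (_ , B⊆[A]) (b , b∈B) with B⊆[A] b b∈B
  ... | a , a∈A , _ = a , a∈A

  ⋈-hasOption : ∀ {p q} → _⋈_ D p q → HasOption q → HasOption p
  ⋈-hasOption (_ , θ-isCongruence , pθq) =
    ClassSetEq-inhabitedʳ⇒inhabitedˡ (IsCongruence.compatible θ-isCongruence pθq)

  Always-isCongruence : (∀ p → HasOption p) → IsCongruence D Always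
  Always-isCongruence hasOption = record
    { isEquivalence = Always.isEquivalence Pos ℓ
    ; compatible    = λ {p} {q} _ → ClassSetEq-total _ (hasOption p) (hasOption q)
    }

  ⋈-total : (∀ p → HasOption p) → ∀ p q → _⋈_ D p q
  ⋈-total hasOption p q = Always , Always-isCongruence hasOption , _

  hasOption⇒oneVertexLoop : (∀ p → HasOption p) → QuotientIsOneVertexLoop D
  hasOption⇒oneVertexLoop hasOption =
    nonempty ,
    (λ p → ⋈-total hasOption p nonempty) ,
    ClassSetEq-total (⋈-total hasOption) (hasOption nonempty) (nonempty , refl)

  oneVertexLoop⇒hasOption : QuotientIsOneVertexLoop D → ∀ p → HasOption p
  oneVertexLoop⇒hasOption (x , p⋈x , Opt-x≈x) p =
    ⋈-hasOption (p⋈x p) (ClassSetEq-inhabitedʳ⇒inhabitedˡ Opt-x≈x (x , refl))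

mainTheorem16 : {ℓ : Level} → ExcludedMiddle ℓ → (D : Optiongraph ℓ) →
    ((∀ p → ¬ Terminal D p) → QuotientIsOneVertexLoop D) ×
    (QuotientIsOneVertexLoop D → ∀ p → ¬ Terminal D p)
mainTheorem16 em D =
  (λ ¬terminal → hasOption⇒oneVertexLoop D λ p → ¬terminal⇒hasOption D em (¬terminal p)) ,
  (λ loop p → hasOption⇒¬terminal D (oneVertexLoop⇒hasOption D loop p))
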